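{- Let $G$ be any finite simple undirected graph, viewed as a position of the Classic Variant of the Mixed Deletion Game. If Right has a legal move in $G$, then Left also has a legal move in $G$. (Equivalently, there is no graph position which contains a move for Right and no move for Left.)
   Context: The Classic Variant of the Mixed Deletion Game is a two-player combinatorial game between Left and Right played on a finite simple undirected graph; players alternate turns. On her turn Left deletes one vertex together with all edges incident to it; on his turn Right deletes one edge. The game ends when a deletion creates an isolated vertex (a vertex of degree $0$), and the player whose deletion created an isolated vertex loses. Thus a legal move is a deletion of the allowed type which does not create an isolated vertex, and a player with no such move loses. -}

module Defs where

open import Data.Nat using (ℕ)
open import Data.Fin using (Fin)
open import Data.Bool using (Bool; true; false)
open import Data.Product using (_×_; ∃-syntax)
open import Data.Sum using (_⊎_)
open import Relation.Nullary using (¬_)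
open import Relation.Binary.PropositionalEquality using (_≡_; _≢_)

record SimpleGraph (n : ℕ) : Set where
  field
    adj    : Fin n → Fin n → Bool
    sym    : ∀ u v → adj u v ≡ adj v u
    irrefl : ∀ v → adj v v ≡ false

open SimpleGraph public

Adj : ∀ {n} → SimpleGraph n → Fin n → Fin n → Set
Adj G u v = adj G u v ≡ true

HasNeighbour : ∀ {n} → SimpleGraph n → Fin n → Set
HasNeighbour G x = ∃[ y ] Adj G x y

-- Left deletes vertex w; this is legal iff it creates no isolated vertex:
-- every remaining vertex x ≠ w that was non-isolated in G still has a
-- neighbour in G - w.
LeftLegal : ∀ {n} → SimpleGraph n → Fin n → Set
LeftLegal G w =
  ∀ x → x ≢ w → HasNeighbour G x → ∃[ y ] (Adj G x y × y ≢ w)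

SameEdge : ∀ {n} → Fin n → Fin n → Fin n → Fin n → Set
SameEdge u v x y = (x ≡ u × y ≡ v) ⊎ (x ≡ v × y ≡ u)

-- Right deletes edge {u,v}; legal iff it is an edge and the deletion
-- creates no isolated vertex: every non-isolated vertex x of G still has a
-- neighbour in G - uv.
RightLegal : ∀ {n} → SimpleGraph n → Fin n → Fin n → Set
RightLegal G u v =
  Adj G u v ×
  (∀ x → HasNeighbour G x → ∃[ y ] (Adj G x y × ¬ SameEdge u v x y))

LeftHasMove : ∀ {n} → SimpleGraph n → Set
LeftHasMove G = ∃[ w ] LeftLegal G w

RightHasMove : ∀ {n} → SimpleGraph n → Set
RightHasMove G = ∃[ u ] ∃[ v ] RightLegal G u v

-- Let uv be a legal edge deletion for Right. If u has a neighbour l whose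
-- only neighbour is u, Left deletes l: the only vertex that could lose its
-- last neighbour is u, and u keeps v ≠ l, for v = l would make l isolated
-- after Right's deletion of uv. Otherwise every neighbour of u has a
-- neighbour besides u, and Left deletes u.
module Submission where

open import Defs
open import Data.Nat using (ℕ)
open import Data.Fin using (Fin; _≟_)
open import Data.Fin.Properties using (any?)
open import Data.Bool using (true)
import Data.Bool as Bool
open import Data.Product using (_×_; _,_; ∃-syntax)
open import Data.Sum using (inj₂)
open import Relation.Nullary using (¬_; Dec; yes; no; contradiction)
open import Relation.Nullary.Decidable using (_×-dec_; ¬?; decidable-stable)
open import Relation.Binary.PropositionalEquality using (_≡_; _≢_; refl; trans)

module _ {n : ℕ} (G : SimpleGraph n) where

  HasNeighbourBesides : Fin n → Fin n → Set
  HasNeighbourBesides w x = ∃[ y ] (Adj G x y × y ≢ w)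

  adj? : ∀ x y → Dec (Adj G x y)
  adj? x y = adj G x y Bool.≟ true

  hasNeighbourBesides? : ∀ w x → Dec (HasNeighbourBesides w x)
  hasNeighbourBesides? w x = any? (λ y → adj? x y ×-dec ¬? (y ≟ w))

  Adj-sym : ∀ {x y} → Adj G x y → Adj G y x
  Adj-sym {x} {y} = trans (sym G y x)

  ¬hasNeighbourBesides⇒onlyNeighbour :
    ∀ {w x} → ¬ HasNeighbourBesides w x → ∀ {y} → Adj G x y → y ≡ w
  ¬hasNeighbourBesides⇒onlyNeighbour {w} none {y} xy with y ≟ w
  ... | yes y≡w = y≡w
  ... | no  y≢w = contradiction (y , xy , y≢w) none

  leftLegal-neighbours : ∀ {w} →
    (∀ x → Adj G w x → HasNeighbourBesides w x) → LeftLegal G w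
  leftLegal-neighbours {w} neighbours x x≢w (y , xy) with y ≟ w
  ... | no  y≢w  = y , xy , y≢w
  ... | yes refl = neighbours x (Adj-sym xy)

  leftLegal-pendant : ∀ {u v l} → RightLegal G u v →
    (∀ {y} → Adj G l y → y ≡ u) → LeftLegal G l
  leftLegal-pendant {u} {v} {l} (uv , keeps) onlyU x x≢l nonIsolated
    with keeps x nonIsolated
  ... | y , xy , _ with y ≟ l
  ...   | no  y≢l  = y , xy , y≢l
  ...   | yes refl with onlyU (Adj-sym xy)
  ...     | refl with v ≟ l
  ...       | no  v≢l  = v , uv , v≢l
  ...       | yes refl with keeps v (u , Adj-sym uv)
  ...         | z , vz , notUV = contradiction (inj₂ (refl , onlyU vz)) notUV

  rightMove⇒leftMove : ∀ u v → RightLegal G u v → LeftHasMove G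
  rightMove⇒leftMove u v right with any? (λ l → ¬? (hasNeighbourBesides? u l))
  ... | yes (l , none) =
    l , leftLegal-pendant right (¬hasNeighbourBesides⇒onlyNeighbour none)
  ... | no noPendant =
    u , leftLegal-neighbours λ x _ →
      decidable-stable (hasNeighbourBesides? u x) (λ none → noPendant (x , none))

proposition3p2 : (n : ℕ) (G : SimpleGraph n) → RightHasMove G → LeftHasMove G
proposition3p2 n G (u , v , right) = rightMove⇒leftMove G u v right
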